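{- Let $\mathbf L=(L,\vee,\wedge,0,1)$ be a complemented lattice and $D$ a compatible deductive system of $\mathbf L$. Then: (i) $\Theta(D)$ is an equivalence relation on $L$ having the Substitution Property with respect to $\to$; (ii) $[1]\big(\Theta(D)\big)=D$.
   Context: A bounded lattice is complemented if every element $a$ has some $b$ with $a\vee b=1$, $a\wedge b=0$ (complements need not be unique); lattices are non-trivial. For $a\in L$, $a^+:=\{x\in L\mid a\vee x=1,\ a\wedge x=0\}$, $a\to b:=\{x\vee(a\wedge b)\mid x\in a^+\}$, and for $B\subseteq L$, $a\to B:=\{x\vee(a\wedge y)\mid x\in a^+,\ y\in B\}$. A deductive system of $\mathbf L$ is a subset $D\subseteq L$ with $1\in D$ such that whenever $a\in D$, $b\in L$ and $a\to b\subseteq D$, then $b\in D$. It is compatible if additionally for all $a,b,c,d\in L$: (1) if $a\to b\subseteq D$ and $x\to(c\to d)\subseteq D$ for all $x\in a\to b$, then $c\to d\subseteq D$; (2) if $a\to b\subseteq D$ and $b\to a\subseteq D$, then $x\to(b\to c)\subseteq D$ for all $x\in a\to c$. $\Theta(D):=\{(x,y)\in L^2\mid x\to y\subseteq D\text{ and }y\to x\subseteq D\}$. An equivalence relation $\Phi$ has the Substitution Property with respect to $\to$ if $(a,b)\in\Phi$ implies $(a\to c)\times(b\to c)\subseteq\Phi$ for all $c\in L$. $[1]\Phi$ is the class of $1$. -}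

module Defs where

open import Level using (Level; _⊔_; suc)
open import Data.Product using (_×_; Σ; ∃; _,_)
open import Relation.Binary.Core using (Rel)
open import Relation.Binary.Structures using (IsEquivalence)
open import Relation.Unary using (Pred)
open import Relation.Nullary using (¬_)
open import Algebra.Lattice.Bundles using (Lattice)

record BoundedLattice (c ℓ : Level) : Set (suc (c ⊔ ℓ)) where
  field
    lattice : Lattice c ℓ
  open Lattice lattice public
  field
    𝟘 : Carrier
    𝟙 : Carrier
    𝟘-least    : ∀ x → (𝟘 ∧ x) ≈ 𝟘
    𝟙-greatest : ∀ x → (𝟙 ∨ x) ≈ 𝟙
    nontrivial : ¬ (𝟘 ≈ 𝟙)

module _ {c ℓ : Level} (𝐋 : BoundedLattice c ℓ) where
  open BoundedLattice 𝐋

  _⁺ : Carrier → Pred Carrier ℓ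
  (a ⁺) x = ((a ∨ x) ≈ 𝟙) × ((a ∧ x) ≈ 𝟘)

  IsComplemented : Set (c ⊔ ℓ)
  IsComplemented = ∀ a → ∃ λ b → (a ⁺) b

  _⇒_ : Carrier → Carrier → Pred Carrier (c ⊔ ℓ)
  (a ⇒ b) z = ∃ λ x → (a ⁺) x × (z ≈ (x ∨ (a ∧ b)))

  _⊆_ : ∀ {p q} → Pred Carrier p → Pred Carrier q → Set (c ⊔ p ⊔ q)
  S ⊆ D = ∀ {z} → S z → D z

  -- subsets of L are predicates closed under the lattice equality
  RespectsEq : ∀ {p} → Pred Carrier p → Set (c ⊔ ℓ ⊔ p)
  RespectsEq D = ∀ {x y} → x ≈ y → D x → D y

  record IsDeductiveSystem {p} (D : Pred Carrier p) : Set (c ⊔ ℓ ⊔ p) where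
    field
      respects : RespectsEq D
      one∈     : D 𝟙
      mp       : ∀ a b → D a → (a ⇒ b) ⊆ D → D b

  _⇒S_ : ∀ {p} → Carrier → Pred Carrier p → Pred Carrier (c ⊔ ℓ ⊔ p)
  (a ⇒S B) z = ∃ λ x → ∃ λ y → (a ⁺) x × B y × (z ≈ (x ∨ (a ∧ y)))

  record IsCompatibleDS {p} (D : Pred Carrier p) : Set (c ⊔ ℓ ⊔ p) where
    field
      isDS    : IsDeductiveSystem D
      compat₁ : ∀ a b c′ d → (a ⇒ b) ⊆ D
              → (∀ x → (a ⇒ b) x → (x ⇒S (c′ ⇒ d)) ⊆ D)
              → (c′ ⇒ d) ⊆ D
      compat₂ : ∀ a b c′ → (a ⇒ b) ⊆ D → (b ⇒ a) ⊆ D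
              → ∀ x → (a ⇒ c′) x → (x ⇒S (b ⇒ c′)) ⊆ D

  Θ : ∀ {p} → Pred Carrier p → Rel Carrier (c ⊔ ℓ ⊔ p)
  Θ D x y = ((x ⇒ y) ⊆ D) × ((y ⇒ x) ⊆ D)

  IsEquivOnL : ∀ {r} → Rel Carrier r → Set (c ⊔ ℓ ⊔ r)
  IsEquivOnL Φ = (∀ {x y} → x ≈ y → Φ x y)
               × (∀ {x y} → Φ x y → Φ y x)
               × (∀ {x y z} → Φ x y → Φ y z → Φ x z)

  SubstProp : ∀ {r} → Rel Carrier r → Set (c ⊔ ℓ ⊔ r)
  SubstProp Φ = ∀ a b c′ → Φ a b → ∀ x y → (a ⇒ c′) x → (b ⇒ c′) y → Φ x y

  classOf1 : ∀ {r} → Rel Carrier r → Pred Carrier r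
  classOf1 Φ x = Φ x 𝟙

-- Every element of a → b is x ∨ (a ∧ b) with a ∨ x ≈ 1, so it equals 1 as soon as a ∧ b ≈ a;
-- this makes Θ(D) reflexive and gives x → 1 = {1}.  Since the only complement of 1 is 0,
-- 1 → x = {x}, so x Θ(D) 1 yields x ∈ D by modus ponens from 1 ∈ D.  Symmetry is built into
-- Θ(D), and transitivity and the substitution property are what compatibility (1) and (2) provide.
module Submission where

open import Level using (Level; _⊔_)
open import Data.Product using (_×_; _,_)
open import Relation.Binary.Core using (Rel)
open import Relation.Unary using (Pred)
open import Defs using (BoundedLattice; IsComplemented; IsDeductiveSystem; IsCompatibleDS)
import Algebra.Lattice.Properties.Lattice as LatticeProperties
import Relation.Binary.Reasoning.Setoid as SetoidReasoning

module BoundedLatticeProperties {c ℓ : Level} (𝐋 : BoundedLattice c ℓ) where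
  open BoundedLattice 𝐋
  open LatticeProperties lattice using (∧-idem)
  open SetoidReasoning setoid

  private
    _⁺ : Carrier → Pred Carrier ℓ
    _⁺ = Defs._⁺ 𝐋

    _⇒_ : Carrier → Carrier → Pred Carrier (c ⊔ ℓ)
    _⇒_ = Defs._⇒_ 𝐋

    _⊆_ : ∀ {p q} → Pred Carrier p → Pred Carrier q → Set (c ⊔ p ⊔ q)
    _⊆_ = Defs._⊆_ 𝐋

    Θ : ∀ {p} → Pred Carrier p → Rel Carrier (c ⊔ ℓ ⊔ p)
    Θ = Defs.Θ 𝐋

    classOf1 : ∀ {r} → Rel Carrier r → Pred Carrier r
    classOf1 = Defs.classOf1 𝐋

  ∧-identityʳ : ∀ x → (x ∧ 𝟙) ≈ x
  ∧-identityʳ x = begin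
    x ∧ 𝟙        ≈⟨ ∧-congˡ (trans (∨-comm x 𝟙) (𝟙-greatest x)) ⟨
    x ∧ (x ∨ 𝟙)  ≈⟨ ∧-absorbs-∨ x 𝟙 ⟩
    x            ∎

  ∨-identityʳ : ∀ x → (x ∨ 𝟘) ≈ x
  ∨-identityʳ x = begin
    x ∨ 𝟘        ≈⟨ ∨-congˡ (trans (∧-comm x 𝟘) (𝟘-least x)) ⟨
    x ∨ (x ∧ 𝟘)  ≈⟨ ∨-absorbs-∧ x 𝟘 ⟩
    x            ∎

  𝟙⁺-≈𝟘 : (𝟙 ⁺) ⊆ (_≈ 𝟘)
  𝟙⁺-≈𝟘 {x} (_ , 𝟙∧x≈𝟘) = begin
    x      ≈⟨ ∧-identityʳ x ⟨
    x ∧ 𝟙  ≈⟨ ∧-comm x 𝟙 ⟩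
    𝟙 ∧ x  ≈⟨ 𝟙∧x≈𝟘 ⟩
    𝟘      ∎

  ⇒-≈𝟙 : ∀ {a b} → (a ∧ b) ≈ a → (a ⇒ b) ⊆ (_≈ 𝟙)
  ⇒-≈𝟙 {a} {b} a∧b≈a {z} (x , (a∨x≈𝟙 , _) , z≈x∨a∧b) = begin
    z            ≈⟨ z≈x∨a∧b ⟩
    x ∨ (a ∧ b)  ≈⟨ ∨-congˡ a∧b≈a ⟩
    x ∨ a        ≈⟨ ∨-comm x a ⟩
    a ∨ x        ≈⟨ a∨x≈𝟙 ⟩
    𝟙            ∎

  𝟙⇒-≈ : ∀ {b} → (𝟙 ⇒ b) ⊆ (_≈ b)
  𝟙⇒-≈ {b} {z} (x , x∈𝟙⁺ , z≈x∨𝟙∧b) = begin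
    z              ≈⟨ z≈x∨𝟙∧b ⟩
    x ∨ (𝟙 ∧ b)    ≈⟨ ∨-cong (𝟙⁺-≈𝟘 x∈𝟙⁺) (∧-comm 𝟙 b) ⟩
    𝟘 ∨ (b ∧ 𝟙)    ≈⟨ ∨-comm 𝟘 (b ∧ 𝟙) ⟩
    (b ∧ 𝟙) ∨ 𝟘    ≈⟨ ∨-identityʳ (b ∧ 𝟙) ⟩
    b ∧ 𝟙          ≈⟨ ∧-identityʳ b ⟩
    b              ∎

  module DeductiveSystemProperties {p} {D : Pred Carrier p} (isDS : IsDeductiveSystem 𝐋 D) where
    open IsDeductiveSystem isDS

    ⇒⊆D : ∀ {a b} → (a ∧ b) ≈ a → (a ⇒ b) ⊆ D
    ⇒⊆D a∧b≈a z∈a⇒b = respects (sym (⇒-≈𝟙 a∧b≈a z∈a⇒b)) one∈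

    Θ-refl : ∀ {x y} → x ≈ y → Θ D x y
    Θ-refl x≈y = ⇒⊆D (∧-absorbing x≈y) , ⇒⊆D (∧-absorbing (sym x≈y))
      where
      ∧-absorbing : ∀ {u v} → u ≈ v → (u ∧ v) ≈ u
      ∧-absorbing {u} u≈v = trans (∧-congˡ (sym u≈v)) (∧-idem u)

    [1]Θ⊆D : classOf1 (Θ D) ⊆ D
    [1]Θ⊆D {x} (_ , 𝟙⇒x⊆D) = mp 𝟙 x one∈ 𝟙⇒x⊆D

    D⊆[1]Θ : D ⊆ classOf1 (Θ D)
    D⊆[1]Θ {x} x∈D = ⇒⊆D (∧-identityʳ x) , λ z∈𝟙⇒x → respects (sym (𝟙⇒-≈ z∈𝟙⇒x)) x∈D

  module CompatibleDSProperties {p} {D : Pred Carrier p} (cds : IsCompatibleDS 𝐋 D) where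
    open IsCompatibleDS cds

    Θ-sym : ∀ {x y} → Θ D x y → Θ D y x
    Θ-sym (x⇒y⊆D , y⇒x⊆D) = y⇒x⊆D , x⇒y⊆D

    Θ-trans : ∀ {x y z} → Θ D x y → Θ D y z → Θ D x z
    Θ-trans {x} {y} {z} (x⇒y⊆D , y⇒x⊆D) (y⇒z⊆D , z⇒y⊆D) =
      compat₁ y z x z y⇒z⊆D (compat₂ y x z y⇒x⊆D x⇒y⊆D) ,
      compat₁ y x z x y⇒x⊆D (compat₂ y z x y⇒z⊆D z⇒y⊆D)

    Θ-substitutive : Defs.SubstProp 𝐋 (Θ D)
    Θ-substitutive a b c′ (a⇒b⊆D , b⇒a⊆D) x y x∈a⇒c′ y∈b⇒c′ =
      (λ { (w , w∈x⁺ , e) → compat₂ a b c′ a⇒b⊆D b⇒a⊆D x x∈a⇒c′ (w , y , w∈x⁺ , y∈b⇒c′ , e) }) ,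
      (λ { (w , w∈y⁺ , e) → compat₂ b a c′ b⇒a⊆D a⇒b⊆D y y∈b⇒c′ (w , x , w∈y⁺ , x∈a⇒c′ , e) })

open Defs using (_⊆_; Θ; IsEquivOnL; SubstProp; classOf1)

theorem5p10 : ∀ {c ℓ p : Level} (𝐋 : BoundedLattice c ℓ) → IsComplemented 𝐋
    → (D : Pred (BoundedLattice.Carrier 𝐋) p) → IsCompatibleDS 𝐋 D
    → (IsEquivOnL 𝐋 (Θ 𝐋 D) × SubstProp 𝐋 (Θ 𝐋 D))
    × (_⊆_ 𝐋 (classOf1 𝐋 (Θ 𝐋 D)) D × _⊆_ 𝐋 D (classOf1 𝐋 (Θ 𝐋 D)))
theorem5p10 𝐋 _ D cds =
  ((Θ-refl , Θ-sym , Θ-trans) , Θ-substitutive) , ([1]Θ⊆D , D⊆[1]Θ)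
  where
  open BoundedLatticeProperties 𝐋
  open CompatibleDSProperties cds
  open DeductiveSystemProperties (IsCompatibleDS.isDS cds)
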